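{- Let $a,b,k,n$ be positive integers with $n\geq\max\{a+b,a+k\}$ and let $A$ be an $a$-subset of $[n]$. Suppose that $K$ is the $k$-partner of $A\setminus A^{\mathrm t}$, and that there exists a $b$-subset $B$ of $[n]$ such that $(A,B)$ is maximal; let $b'=|B\setminus B^{\mathrm t}|$. Then $(A,K)$ is maximal if and only if $k\geq b'$.
   Context: Lexicographic order: for finite sets $A,B$ of positive integers, $A\prec B$ if either $A\supseteq B$ or $\min(A\setminus B)<\min(B\setminus A)$. For a $k$-subset $R$ of $[n]$, $\mathcal{L}(R,k)=\{F\in\binom{[n]}{k}:F\prec R\}$. For $F\subseteq[n]$, $\ell(F)=\max\{x:[n-x+1,n]\subseteq F\}$ if $n\in F$ and $\ell(F)=0$ otherwise; $F^{\mathrm t}=[n-\ell(F)+1,n]$ (empty if $\ell(F)=0$). $H$ is the partner of a nonempty set $F$ if there is $q$ with $F\cap H=\{q\}$ and $F\cup H=[q]$. For $F\subseteq[n]$ with $|F|=f$ and $k\le n-f$, let $H$ be the partner of $F$ and $h=|H|$; the $k$-partner $K$ of $F$ is: $K=H$ if $k=h$; $K=H\cup\{n-k+h+1,\dots,n\}$ if $k>h$; and if $k<h$, $K$ is the lexicographically last $k$-subset of $[n]$ with $K\prec H$. Families are cross-intersecting if every member of one meets every member of the other; a cross-intersecting pair $(\mathcal{F},\mathcal{G})$ of uniform families is maximal if it cannot be enlarged (in either family, keeping uniformities) while remaining cross-intersecting. For sets $F,G$, $(F,G)$ is maximal if $\mathcal{L}(F,|F|)$ and $\mathcal{L}(G,|G|)$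 are cross-intersecting and form a maximal pair. -}

module Defs where

-- Conventions: a subset of [n] = {1,…,n} is a `Subset n` (Data.Fin.Subset);
-- the element `i : Fin n` stands for the positive integer `toℕ i + 1`,
-- so the order on Fin n is the order on [n].

open import Data.Nat using (ℕ; zero; suc; _∸_; _<_; _≤?_)
open import Data.Fin using (Fin; toℕ) renaming (_<_ to _<ᶠ_)
open import Data.Fin.Subset using (Subset; _∈_; _∉_; _⊆_; _∩_; _∪_; ⁅_⁆; ∣_∣)
open import Data.Fin.Subset.Properties using (_⊆?_)
open import Data.Vec using (tabulate)
open import Data.Bool using (if_then_else_)
open import Data.Product using (Σ; _×_; ∃; ∃-syntax)
open import Data.Sum using (_⊎_)
open import Relation.Nullary using (does)
open import Relation.Binary.PropositionalEquality using (_≡_)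
open import Level using (Level) renaming (suc to lsuc; zero to lzero)

private variable n : ℕ

-- Lexicographic order:  A ≺ B  iff  A ⊇ B  or  min(A∖B) < min(B∖A)
-- (with min ∅ = ∞; i.e. A∖B has an element smaller than every element of B∖A).
_≺_ : Subset n → Subset n → Set
A ≺ B = (B ⊆ A) ⊎ (∃[ x ] (x ∈ A × x ∉ B × (∀ y → y ∈ B → y ∉ A → x <ᶠ y)))

𝓛 : Subset n → ℕ → Subset n → Set
𝓛 R k F = ∣ F ∣ ≡ k × F ≺ R

-- [n-x+1, n]
top : (n x : ℕ) → Subset n
top n x = tabulate (λ i → does (n ∸ x ≤? toℕ i))

-- [q] = {1,…,q}
initial : Fin n → Subset n
initial {n} q = tabulate (λ j → does (toℕ j ≤? toℕ q))

findMax : Subset n → ℕ → ℕ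
findMax F zero = zero
findMax {n} F (suc x) = if does (top n (suc x) ⊆? F) then suc x else findMax F x

-- ℓ(F) = max{x : [n-x+1,n] ⊆ F}  (this is 0 when n ∉ F)
ℓ : Subset n → ℕ
ℓ {n} F = findMax F n

tail : Subset n → Subset n
tail {n} F = top n (ℓ F)

IsPartner : Subset n → Subset n → Set
IsPartner F H = ∃[ q ] (F ∩ H ≡ ⁅ q ⁆ × F ∪ H ≡ initial q)

IsKPartner : ℕ → Subset n → Subset n → Set
IsKPartner {n} k F K =
  (∣ F ∣ + k ≤ n) ×
  ∃[ H ] (IsPartner F H ×
    ( (k ≡ ∣ H ∣ × K ≡ H)
    ⊎ (∣ H ∣ < k × K ≡ H ∪ top n (k ∸ ∣ H ∣))
    ⊎ (k < ∣ H ∣ × ∣ K ∣ ≡ k × K ≺ H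
         × (∀ K′ → ∣ K′ ∣ ≡ k → K′ ≺ H → K′ ≺ K))))
  where open import Data.Nat using (_+_; _≤_)

Family : ℕ → Set₁
Family n = Subset n → Set

Uniform : ℕ → Family n → Set
Uniform k 𝓕 = ∀ F → 𝓕 F → ∣ F ∣ ≡ k

CrossIntersecting : Family n → Family n → Set
CrossIntersecting 𝓕 𝓖 = ∀ F G → 𝓕 F → 𝓖 G → ∃[ x ] (x ∈ F × x ∈ G)

_⊑_ : Family n → Family n → Set
𝓕 ⊑ 𝓕′ = ∀ F → 𝓕 F → 𝓕′ F

MaximalPair : ℕ → ℕ → Family n → Family n → Set₁
MaximalPair {n} f g 𝓕 𝓖 =
  CrossIntersecting 𝓕 𝓖 ×
  (∀ (𝓕′ 𝓖′ : Family n) → Uniform f 𝓕′ → Uniform g 𝓖′ →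
     𝓕 ⊑ 𝓕′ → 𝓖 ⊑ 𝓖′ → CrossIntersecting 𝓕′ 𝓖′ →
     (𝓕′ ⊑ 𝓕 × 𝓖′ ⊑ 𝓖))

Maximal : Subset n → Subset n → Set₁
Maximal F G = MaximalPair ∣ F ∣ ∣ G ∣ (𝓛 F ∣ F ∣) (𝓛 G ∣ G ∣)

{-# OPTIONS --safe #-}
module Submission where

-- Let F = A ∖ Aᵗ, let H be its partner and F ∩ H = {q}.  A set F ∪ [n-m+1, n] and a set
-- H ∪ [n-m′+1, n], with both blocks above q, form a maximal pair whenever their sizes add up to at
-- most n: members of their 𝓛-families meet inside [q] = F ∪ H, and a set outside one family is
-- avoided by a member of the other grown from its first difference.  Conversely, A has a gap just
-- below Aᵗ, above q, and an exchange of q for that gap shows that every C maximal with A contains H.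
-- Since the maximal partner of a given size is unique, B = H ∪ [n-(b-|H|)+1, n], so b′ = |H|, and
-- the three shapes of the k-partner K show that (A, K) is maximal exactly when |H| ≤ k.

open import Defs
open import Data.Empty using (⊥; ⊥-elim)
open import Data.Fin using (Fin; toℕ; fromℕ<) renaming (_<_ to _<ᶠ_; _≤_ to _≤ᶠ_)
import Data.Fin.Properties as Fin
open import Data.Fin.Subset hiding (⊥)
open import Data.Fin.Subset.Properties
open import Data.Nat
  using (ℕ; zero; suc; pred; _+_; _∸_; _≤_; _<_; _≤?_; z≤n; s≤s; s≤s⁻¹; _⊔_; >-nonZero)
open import Data.Nat.Properties
open import Data.Product using (_×_; _,_; proj₁; proj₂; ∃)
open import Data.Sum using (_⊎_; inj₁; inj₂; swap)
open import Data.Vec using ([]; _∷_; tabulate; here; there)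
open import Data.Vec.Properties using (lookup∘tabulate; []=⇒lookup; lookup⇒[]=; tabulate-cong)
open import Function using (_∘_; _∘₂_; case_of_)
open import Function.Bundles using (_⇔_; mk⇔)
open import Relation.Binary.Definitions using (tri<; tri≈; tri>)
open import Relation.Binary.PropositionalEquality
  using (_≡_; refl; sym; trans; cong; cong₂; subst; module ≡-Reasoning)
open import Relation.Nullary using (yes; no; does; ¬_; ¬?; contradiction)
open import Relation.Nullary.Decidable using (dec-true; does-⇔; decidable-stable; _×-dec_; _⊎-dec_)
open import Relation.Unary using (Decidable)

private variable n : ℕ

module _ {P : Fin n → Set} (P? : Decidable P) where

  ∈-tabulate⁺ : ∀ {i} → P i → i ∈ tabulate (does ∘ P?)
  ∈-tabulate⁺ {i} p = lookup⇒[]= i _ (trans (lookup∘tabulate (does ∘ P?) i) (dec-true (P? i) p))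

  ∈-tabulate⁻ : ∀ {i} → i ∈ tabulate (does ∘ P?) → P i
  ∈-tabulate⁻ {i} i∈ with P? i | trans (sym (lookup∘tabulate (does ∘ P?) i)) ([]=⇒lookup i∈)
  ... | yes p | _  = p
  ... | no _  | ()

∈top⁺ : ∀ m {i : Fin n} → n ∸ m ≤ toℕ i → i ∈ top n m
∈top⁺ {n} m = ∈-tabulate⁺ (λ i → n ∸ m ≤? toℕ i)

∈top⁻ : ∀ m {i : Fin n} → i ∈ top n m → n ∸ m ≤ toℕ i
∈top⁻ {n} m = ∈-tabulate⁻ (λ i → n ∸ m ≤? toℕ i)

∈initial⁺ : ∀ {q i : Fin n} → i ≤ᶠ q → i ∈ initial q
∈initial⁺ {q = q} = ∈-tabulate⁺ (λ i → toℕ i ≤? toℕ q)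

∈initial⁻ : ∀ {q i : Fin n} → i ∈ initial q → i ≤ᶠ q
∈initial⁻ {q = q} = ∈-tabulate⁻ (λ i → toℕ i ≤? toℕ q)

∉top⇒< : ∀ {m} {i j : Fin n} → i ∉ top n m → j ∈ top n m → i <ᶠ j
∉top⇒< {m = m} i∉ j∈ = <-≤-trans (≰⇒> (i∉ ∘ ∈top⁺ m)) (∈top⁻ m j∈)

∉top⇒<n : ∀ m {j : Fin n} → j ∉ top n m → m < n
∉top⇒<n m {j} j∉top = ≰⇒> λ n≤m → j∉top (∈top⁺ m (subst (_≤ toℕ j) (sym (m≤n⇒m∸n≡0 n≤m)) z≤n))

top-mono : ∀ {m m′} → m ≤ m′ → top n m ⊆ top n m′
top-mono {n} {m} {m′} m≤m′ j∈ = ∈top⁺ m′ (≤-trans (∸-monoʳ-≤ n m≤m′) (∈top⁻ m j∈))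

top-zero-empty : ∀ {j : Fin n} → j ∉ top n 0
top-zero-empty {j = j} j∈ = <⇒≱ (Fin.toℕ<n j) (∈top⁻ 0 j∈)

x∈p─q⇒x∉q : ∀ {x : Fin n} (p q : Subset n) → x ∈ p ─ q → x ∉ q
x∈p─q⇒x∉q (_ ∷ p) (inside ∷ q) () here
x∈p─q⇒x∉q (_ ∷ p) (_ ∷ q) (there x∈) (there x∈q) = x∈p─q⇒x∉q p q x∈ x∈q

⊆-or-∃∉ : (p q : Subset n) → p ⊆ q ⊎ ∃ λ x → x ∈ p × x ∉ q
⊆-or-∃∉ p q with Fin.any? (λ x → x ∈? p ×-dec ¬? (x ∈? q))
... | yes (x , x∈p , x∉q) = inj₂ (x , x∈p , x∉q)
... | no ∄x               = inj₁ λ {x} x∈p → decidable-stable (x ∈? q) λ x∉q → ∄x (x , x∈p , x∉q)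

least : ∀ {P : Fin n → Set} → Decidable P → ∃ P → ∃ λ i → P i × (∀ {j} → j <ᶠ i → ¬ P j)
least {suc n} {P} P? (w , Pw) with P? Fin.zero | w
... | yes P0 | _      = Fin.zero , P0 , λ ()
... | no ¬P0 | Fin.zero = contradiction Pw ¬P0
... | no ¬P0 | Fin.suc w′ with least (P? ∘ Fin.suc) (w′ , Pw)
...   | i , Pi , below-i = Fin.suc i , Pi , below-suc-i
  where
  below-suc-i : ∀ {j} → j <ᶠ Fin.suc i → ¬ P j
  below-suc-i {Fin.zero}  _         = ¬P0
  below-suc-i {Fin.suc j} (s≤s j<i) = below-i j<i

-- Cardinalities

∣top∣ : ∀ n m → m ≤ n → ∣ top n m ∣ ≡ m
∣top∣ n m m≤n = trans (∣≥∣ n (n ∸ m)) (m∸[m∸n]≡n m≤n)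
  where
  ∣≥∣ : ∀ n t → ∣ tabulate {n = n} (λ i → does (t ≤? toℕ i)) ∣ ≡ n ∸ t
  ∣≥∣ zero    zero    = refl
  ∣≥∣ zero    (suc t) = refl
  ∣≥∣ (suc n) zero    = cong suc (∣≥∣ n zero)
  ∣≥∣ (suc n) (suc t) = trans
    (cong (∣_∣ {n = n}) (tabulate-cong λ i → does-⇔ (mk⇔ s≤s⁻¹ s≤s) (suc t ≤? suc (toℕ i)) (t ≤? toℕ i)))
    (∣≥∣ n t)

∣initial∣ : (q : Fin n) → ∣ initial q ∣ ≡ suc (toℕ q)
∣initial∣ {n} q = ∣≤∣ n (toℕ q) (Fin.toℕ<n q)
  where
  ∣false∣ : ∀ n → ∣ tabulate {n = n} (λ i → does (suc (toℕ i) ≤? 0)) ∣ ≡ 0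
  ∣false∣ zero    = refl
  ∣false∣ (suc n) = ∣false∣ n
  ∣≤∣ : ∀ n t → t < n → ∣ tabulate {n = n} (λ i → does (toℕ i ≤? t)) ∣ ≡ suc t
  ∣≤∣ (suc n) zero    _          = cong suc (∣false∣ n)
  ∣≤∣ (suc n) (suc t) (s≤s t<n) = cong suc (trans
    (cong (∣_∣ {n = n}) (tabulate-cong λ i → does-⇔ (mk⇔ s≤s⁻¹ s≤s) (suc (toℕ i) ≤? suc t) (toℕ i ≤? t)))
    (∣≤∣ n t t<n))

∣p∪q∣+∣p∩q∣≡∣p∣+∣q∣ : (p q : Subset n) → ∣ p ∪ q ∣ + ∣ p ∩ q ∣ ≡ ∣ p ∣ + ∣ q ∣
∣p∪q∣+∣p∩q∣≡∣p∣+∣q∣ []            []            = refl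
∣p∪q∣+∣p∩q∣≡∣p∣+∣q∣ (inside ∷ p)  (inside ∷ q)  =
  cong suc (trans (+-suc _ _) (trans (cong suc (∣p∪q∣+∣p∩q∣≡∣p∣+∣q∣ p q)) (sym (+-suc _ _))))
∣p∪q∣+∣p∩q∣≡∣p∣+∣q∣ (inside ∷ p)  (outside ∷ q) = cong suc (∣p∪q∣+∣p∩q∣≡∣p∣+∣q∣ p q)
∣p∪q∣+∣p∩q∣≡∣p∣+∣q∣ (outside ∷ p) (inside ∷ q)  =
  trans (cong suc (∣p∪q∣+∣p∩q∣≡∣p∣+∣q∣ p q)) (sym (+-suc _ _))
∣p∪q∣+∣p∩q∣≡∣p∣+∣q∣ (outside ∷ p) (outside ∷ q) = ∣p∪q∣+∣p∩q∣≡∣p∣+∣q∣ p q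

∣p∪q∣≤∣p∣+∣q∣ : (p q : Subset n) → ∣ p ∪ q ∣ ≤ ∣ p ∣ + ∣ q ∣
∣p∪q∣≤∣p∣+∣q∣ p q = subst (∣ p ∪ q ∣ ≤_) (∣p∪q∣+∣p∩q∣≡∣p∣+∣q∣ p q) (m≤m+n _ _)

Empty-∩⇒∣p∪q∣≡∣p∣+∣q∣ : (p q : Subset n) → Empty (p ∩ q) → ∣ p ∪ q ∣ ≡ ∣ p ∣ + ∣ q ∣
Empty-∩⇒∣p∪q∣≡∣p∣+∣q∣ {n} p q empty = begin
  ∣ p ∪ q ∣             ≡⟨ +-identityʳ _ ⟨
  ∣ p ∪ q ∣ + 0         ≡⟨ cong (∣ p ∪ q ∣ +_) (trans (cong ∣_∣ (Empty-unique empty)) (∣⊥∣≡0 n)) ⟨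
  ∣ p ∪ q ∣ + ∣ p ∩ q ∣ ≡⟨ ∣p∪q∣+∣p∩q∣≡∣p∣+∣q∣ p q ⟩
  ∣ p ∣ + ∣ q ∣         ∎
  where open ≡-Reasoning

∣p∪⁅x⁆∣≤∣p∣+1 : (p : Subset n) (x : Fin n) → ∣ p ∪ ⁅ x ⁆ ∣ ≤ ∣ p ∣ + 1
∣p∪⁅x⁆∣≤∣p∣+1 p x = subst (∣ p ∪ ⁅ x ⁆ ∣ ≤_) (cong (∣ p ∣ +_) (∣⁅x⁆∣≡1 x)) (∣p∪q∣≤∣p∣+∣q∣ p ⁅ x ⁆)

x∈p⇒∣p∣≡∣p-x∣+1 : ∀ {x} {p : Subset n} → x ∈ p → ∣ p ∣ ≡ ∣ p - x ∣ + 1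
x∈p⇒∣p∣≡∣p-x∣+1 {x = x} {p} x∈p = ≤-antisym
  (≤-trans (p⊆q⇒∣p∣≤∣q∣ p⊆p-x∪x) (∣p∪⁅x⁆∣≤∣p∣+1 (p - x) x))
  (subst (_≤ ∣ p ∣) (+-comm 1 _) (x∈p⇒∣p-x∣<∣p∣ x∈p))
  where
  p⊆p-x∪x : p ⊆ (p - x) ∪ ⁅ x ⁆
  p⊆p-x∪x {y} y∈p with y Fin.≟ x
  ... | yes refl = x∈p∪q⁺ (inj₂ (x∈⁅x⁆ x))
  ... | no y≢x   = x∈p∪q⁺ (inj₁ (x∈p∧x≢y⇒x∈p-y y∈p y≢x))

x∈p⇒∣p-x∪⁅y⁆∣≤∣p∣ : ∀ {x} {p : Subset n} (y : Fin n) → x ∈ p → ∣ (p - x) ∪ ⁅ y ⁆ ∣ ≤ ∣ p ∣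
x∈p⇒∣p-x∪⁅y⁆∣≤∣p∣ {x = x} {p} y x∈p =
  ≤-trans (∣p∪⁅x⁆∣≤∣p∣+1 (p - x) y) (≤-reflexive (sym (x∈p⇒∣p∣≡∣p-x∣+1 x∈p)))

+∣p∣≤n⇒≤∣∁p∣ : ∀ {c} (p : Subset n) → c + ∣ p ∣ ≤ n → c ≤ ∣ ∁ p ∣
+∣p∣≤n⇒≤∣∁p∣ {c = c} p c+∣p∣≤n = subst (c ≤_) (sym (∣∁p∣≡n∸∣p∣ p)) (m+n≤o⇒m≤o∸n c c+∣p∣≤n)

⊆∧∣≡∣⇒≡ : ∀ {p q : Subset n} → p ⊆ q → ∣ p ∣ ≡ ∣ q ∣ → p ≡ q
⊆∧∣≡∣⇒≡ {p = p} {q} p⊆q ∣p∣≡∣q∣ = ⊆-antisym p⊆q λ {x} x∈q →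
  decidable-stable (x ∈? p) λ x∉p → <-irrefl ∣p∣≡∣q∣ (p⊂q⇒∣p∣<∣q∣ (p⊆q , x , x∈q , x∉p))

⊆-interpolate : ∀ {p q : Subset n} → p ⊆ q → ∀ c → ∣ p ∣ ≤ c → c ≤ ∣ q ∣ →
                ∃ λ r → p ⊆ r × r ⊆ q × ∣ r ∣ ≡ c
⊆-interpolate {p = []} {[]} _ zero _ _ = [] , (λ x → x) , (λ x → x) , refl
⊆-interpolate {p = inside ∷ p} {outside ∷ q} p⊆q _ _ _ = contradiction (p⊆q here) λ ()
⊆-interpolate {p = inside ∷ p} {inside ∷ q} p⊆q (suc c) (s≤s l) (s≤s u)
  with r , p⊆r , r⊆q , refl ← ⊆-interpolate (drop-∷-⊆ p⊆q) c l u
  = inside ∷ r , in⊆in p⊆r , in⊆in r⊆q , refl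
⊆-interpolate {p = outside ∷ p} {outside ∷ q} p⊆q c l u
  with r , p⊆r , r⊆q , refl ← ⊆-interpolate (drop-∷-⊆ p⊆q) c l u
  = outside ∷ r , out⊆ p⊆r , out⊆ r⊆q , refl
⊆-interpolate {p = outside ∷ p} {inside ∷ q} p⊆q c l u with c ≤? ∣ q ∣
... | yes c≤∣q∣
  with r , p⊆r , r⊆q , refl ← ⊆-interpolate (drop-∷-⊆ p⊆q) c l c≤∣q∣
  = outside ∷ r , out⊆ p⊆r , out⊆ r⊆q , refl
⊆-interpolate {p = outside ∷ p} {inside ∷ q} p⊆q (suc c) l (s≤s u) | no c≰∣q∣
  with r , p⊆r , r⊆q , refl ←
         ⊆-interpolate (drop-∷-⊆ p⊆q) c (≤-trans (p⊆q⇒∣p∣≤∣q∣ (drop-∷-⊆ p⊆q)) (s≤s⁻¹ (≰⇒> c≰∣q∣))) u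
  = inside ∷ r , out⊆ p⊆r , in⊆in r⊆q , refl
⊆-interpolate {p = outside ∷ p} {inside ∷ q} p⊆q zero l u | no c≰∣q∣ = contradiction z≤n c≰∣q∣

-- Lexicographic order and maximal pairs

≺-witness : ∀ {Y R : Subset n} {i} → i ∈ Y → i ∉ R → (∀ {y} → y ∈ R → y <ᶠ i → y ∈ Y) → Y ≺ R
≺-witness {i = i} i∈Y i∉R R<i⊆Y = inj₂ (i , i∈Y , i∉R , λ y y∈R y∉Y → case Fin.<-cmp y i of λ where
  (tri< y<i _ _)  → contradiction (R<i⊆Y y∈R y<i) y∉Y
  (tri≈ _ refl _) → contradiction y∈R i∉R
  (tri> _ _ i<y)  → i<y)

≺-antisym : ∀ {X Y : Subset n} → ∣ X ∣ ≡ ∣ Y ∣ → X ≺ Y → Y ≺ X → X ≡ Y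
≺-antisym ∣X∣≡∣Y∣ (inj₁ Y⊆X) _          = sym (⊆∧∣≡∣⇒≡ Y⊆X (sym ∣X∣≡∣Y∣))
≺-antisym ∣X∣≡∣Y∣ (inj₂ _)   (inj₁ X⊆Y) = ⊆∧∣≡∣⇒≡ X⊆Y ∣X∣≡∣Y∣
≺-antisym _ (inj₂ (x , x∈X , x∉Y , x<)) (inj₂ (y , y∈Y , y∉X , y<)) =
  ⊥-elim (<-asym (x< y y∈Y y∉X) (y< x x∈X x∉Y))

module _ {A : Subset n} {q g : Fin n} (q∈A : q ∈ A) (g∉A : g ∉ A) where

  ∣exchange∣ : ∣ (A - q) ∪ ⁅ g ⁆ ∣ ≡ ∣ A ∣
  ∣exchange∣ = begin
    ∣ (A - q) ∪ ⁅ g ⁆ ∣   ≡⟨ Empty-∩⇒∣p∪q∣≡∣p∣+∣q∣ (A - q) ⁅ g ⁆ disjoint ⟩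
    ∣ A - q ∣ + ∣ ⁅ g ⁆ ∣ ≡⟨ cong (∣ A - q ∣ +_) (∣⁅x⁆∣≡1 g) ⟩
    ∣ A - q ∣ + 1         ≡⟨ x∈p⇒∣p∣≡∣p-x∣+1 q∈A ⟨
    ∣ A ∣                 ∎
    where
    open ≡-Reasoning
    disjoint : Empty ((A - q) ∩ ⁅ g ⁆)
    disjoint (x , x∈) = let x∈A-q , x∈⁅g⁆ = x∈p∩q⁻ (A - q) ⁅ g ⁆ x∈ in
      g∉A (subst (_∈ A) (x∈⁅y⁆⇒x≡y g x∈⁅g⁆) (p─q⊆p A ⁅ q ⁆ x∈A-q))

  q∉exchange : q <ᶠ g → q ∉ (A - q) ∪ ⁅ g ⁆
  q∉exchange q<g q∈X with x∈p∪q⁻ (A - q) ⁅ g ⁆ q∈X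
  ... | inj₁ q∈A-q = x∈p─q⇒x∉q A ⁅ q ⁆ q∈A-q (x∈⁅x⁆ q)
  ... | inj₂ q∈⁅g⁆ = Fin.<⇒≢ q<g (x∈⁅y⁆⇒x≡y g q∈⁅g⁆)

  exchange-⊀ : q <ᶠ g → ¬ (((A - q) ∪ ⁅ g ⁆) ≺ A)
  exchange-⊀ q<g (inj₁ A⊆X) = q∉exchange q<g (A⊆X q∈A)
  exchange-⊀ q<g (inj₂ (x , x∈X , x∉A , x<)) with x∈p∪q⁻ (A - q) ⁅ g ⁆ x∈X
  ... | inj₁ x∈A-q = x∉A (p─q⊆p A ⁅ q ⁆ x∈A-q)
  ... | inj₂ x∈⁅g⁆ rewrite x∈⁅y⁆⇒x≡y g x∈⁅g⁆ = <-asym q<g (x< q q∈A (q∉exchange q<g))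

Meet : Subset n → Subset n → Set
Meet X Y = ∃ λ x → x ∈ X × x ∈ Y

Meet⇒⊈∁ : ∀ {X Y : Subset n} → Meet X Y → ¬ (Y ⊆ ∁ X)
Meet⇒⊈∁ (x , x∈X , x∈Y) Y⊆∁X = x∈∁p⇒x∉p (Y⊆∁X x∈Y) x∈X

Meet-sym : ∀ {X Y : Subset n} → Meet X Y → Meet Y X
Meet-sym (x , x∈X , x∈Y) = x , x∈Y , x∈X

𝓛-refl : (R : Subset n) → 𝓛 R ∣ R ∣ R
𝓛-refl R = refl , inj₁ (λ x → x)

≺-unless-avoided : ∀ {X A : Subset n} {𝓖 : Family n} → X ≺ A ⊎ (∃ λ Y → 𝓖 Y × Y ⊆ ∁ X) →
                   (∀ Y → 𝓖 Y → Meet X Y) → X ≺ A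
≺-unless-avoided (inj₁ X≺A)             _       = X≺A
≺-unless-avoided (inj₂ (Y , Y∈ , Y⊆∁X)) X-meets = ⊥-elim (Meet⇒⊈∁ (X-meets Y Y∈) Y⊆∁X)

module _ {A C : Subset n} where

  maximal-intro : CrossIntersecting (𝓛 A ∣ A ∣) (𝓛 C ∣ C ∣) →
                  (∀ X → ∣ X ∣ ≡ ∣ A ∣ → X ≺ A ⊎ ∃ λ Y → 𝓛 C ∣ C ∣ Y × Y ⊆ ∁ X) →
                  (∀ Y → ∣ Y ∣ ≡ ∣ C ∣ → Y ≺ C ⊎ ∃ λ X → 𝓛 A ∣ A ∣ X × X ⊆ ∁ Y) →
                  Maximal A C
  maximal-intro cross A-or-avoided C-or-avoided = cross , λ 𝓕 𝓖 𝓕-unif 𝓖-unif 𝓛A⊑𝓕 𝓛C⊑𝓖 𝓕𝓖-cross →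
    (λ X X∈ → 𝓕-unif X X∈ , ≺-unless-avoided (A-or-avoided X (𝓕-unif X X∈))
                               λ Y Y∈ → 𝓕𝓖-cross X Y X∈ (𝓛C⊑𝓖 Y Y∈)) ,
    (λ Y Y∈ → 𝓖-unif Y Y∈ , ≺-unless-avoided (C-or-avoided Y (𝓖-unif Y Y∈))
                               λ X X∈ → Meet-sym (𝓕𝓖-cross X Y (𝓛A⊑𝓕 X X∈) Y∈))

  maximal⇒≺ˡ : Maximal A C → ∀ {X} → ∣ X ∣ ≡ ∣ A ∣ → (∀ Y → 𝓛 C ∣ C ∣ Y → Meet X Y) → X ≺ A
  maximal⇒≺ˡ (cross , maximal) {X} ∣X∣ X-meets =
    proj₂ (proj₁ (maximal 𝓕 (𝓛 C ∣ C ∣) 𝓕-unif (λ _ → proj₁) (λ _ → inj₁) (λ _ Y∈ → Y∈) 𝓕-cross)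
                 X (inj₂ refl))
    where
    𝓕 : Family n
    𝓕 Z = 𝓛 A ∣ A ∣ Z ⊎ Z ≡ X
    𝓕-unif : Uniform ∣ A ∣ 𝓕
    𝓕-unif Z (inj₁ (∣Z∣ , _)) = ∣Z∣
    𝓕-unif Z (inj₂ refl)      = ∣X∣
    𝓕-cross : CrossIntersecting 𝓕 (𝓛 C ∣ C ∣)
    𝓕-cross Z Y (inj₁ Z∈) Y∈ = cross Z Y Z∈ Y∈
    𝓕-cross Z Y (inj₂ refl) Y∈ = X-meets Y Y∈

  maximal⇒≺ʳ : Maximal A C → ∀ {Y} → ∣ Y ∣ ≡ ∣ C ∣ → (∀ X → 𝓛 A ∣ A ∣ X → Meet X Y) → Y ≺ C
  maximal⇒≺ʳ (cross , maximal) {Y} ∣Y∣ Y-meets =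
    proj₂ (proj₂ (maximal (𝓛 A ∣ A ∣) 𝓖 (λ _ → proj₁) 𝓖-unif (λ _ X∈ → X∈) (λ _ → inj₁) 𝓖-cross)
                 Y (inj₂ refl))
    where
    𝓖 : Family n
    𝓖 Z = 𝓛 C ∣ C ∣ Z ⊎ Z ≡ Y
    𝓖-unif : Uniform ∣ C ∣ 𝓖
    𝓖-unif Z (inj₁ (∣Z∣ , _)) = ∣Z∣
    𝓖-unif Z (inj₂ refl)      = ∣Y∣
    𝓖-cross : CrossIntersecting (𝓛 A ∣ A ∣) 𝓖
    𝓖-cross X Z X∈ (inj₁ Z∈)   = cross X Z X∈ Z∈
    𝓖-cross X Z X∈ (inj₂ refl) = Y-meets X X∈

maximal-unique : ∀ {A B C : Subset n} → Maximal A B → Maximal A C → ∣ B ∣ ≡ ∣ C ∣ → B ≡ C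
maximal-unique {B = B} {C} AB AC ∣B∣≡∣C∣ = ≺-antisym ∣B∣≡∣C∣
  (maximal⇒≺ʳ AC ∣B∣≡∣C∣ λ X X∈ → proj₁ AB X B X∈ (𝓛-refl B))
  (maximal⇒≺ʳ AB (sym ∣B∣≡∣C∣) λ X X∈ → proj₁ AC X C X∈ (𝓛-refl C))

-- Partners

-- The shape of A = (A ∖ Aᵗ) ∪ Aᵗ, q being the largest element of A ∖ Aᵗ, and of H ∪ [n-m+1, n].
record TopSplit (R S : Subset n) (m : ℕ) (q : Fin n) : Set where
  field
    head⊆  : S ⊆ R
    top⊆   : top n m ⊆ R
    ∉head  : ∀ {j} → j ∈ R → j ∉ S → j ∈ top n m
    above  : ∀ {j} → j ∈ top n m → q <ᶠ j

  ∈head : ∀ {j} → j ∈ R → j ≤ᶠ q → j ∈ S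
  ∈head {j} j∈R j≤q = decidable-stable (j ∈? S) λ j∉S → <⇒≱ (above (∉head j∈R j∉S)) j≤q

  ≺-of-head⊆ : ∀ {Z} → S ⊆ Z → ∣ Z ∣ ≡ ∣ R ∣ → Z ≺ R
  ≺-of-head⊆ {Z} S⊆Z ∣Z∣≡∣R∣ with ⊆-or-∃∉ R Z
  ... | inj₁ R⊆Z = inj₁ R⊆Z
  ... | inj₂ (r , r∈R , r∉Z) with ⊆-or-∃∉ Z R
  ...   | inj₁ Z⊆R = contradiction (⊆∧∣≡∣⇒≡ Z⊆R ∣Z∣≡∣R∣) λ { refl → r∉Z r∈R }
  ...   | inj₂ (e , e∈Z , e∉R) = inj₂ (e , e∈Z , e∉R , λ y y∈R y∉Z →
            ∉top⇒< {m = m} (e∉R ∘ top⊆) (∉head y∈R (y∉Z ∘ S⊆Z)))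

record Partners (F H : Subset n) (q : Fin n) : Set where
  field
    q∈F       : q ∈ F
    q∈H       : q ∈ H
    meet-at-q : ∀ {j} → j ∈ F → j ∈ H → j ≡ q
    cover     : ∀ {j} → j ≤ᶠ q → j ∈ F ⊎ j ∈ H
    F≤q       : ∀ {j} → j ∈ F → j ≤ᶠ q
    H≤q       : ∀ {j} → j ∈ H → j ≤ᶠ q

Partners-sym : ∀ {F H : Subset n} {q} → Partners F H q → Partners H F q
Partners-sym FH = record
  { q∈F = q∈H ; q∈H = q∈F ; meet-at-q = λ j∈H j∈F → meet-at-q j∈F j∈H
  ; cover = swap ∘ cover ; F≤q = H≤q ; H≤q = F≤q }
  where open Partners FH

module _ {F H : Subset n} {q : Fin n} (F∩H≡q : F ∩ H ≡ ⁅ q ⁆) (F∪H≡[q] : F ∪ H ≡ initial q) where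

  partners : Partners F H q
  partners = record
    { q∈F = proj₁ q∈F∩H ; q∈H = proj₂ q∈F∩H
    ; meet-at-q = λ j∈F j∈H → x∈⁅y⁆⇒x≡y q (subst (_ ∈_) F∩H≡q (x∈p∩q⁺ (j∈F , j∈H)))
    ; cover = λ j≤q → x∈p∪q⁻ F H (subst (_ ∈_) (sym F∪H≡[q]) (∈initial⁺ j≤q))
    ; F≤q = λ j∈F → ∈initial⁻ (subst (_ ∈_) F∪H≡[q] (x∈p∪q⁺ (inj₁ j∈F)))
    ; H≤q = λ j∈H → ∈initial⁻ (subst (_ ∈_) F∪H≡[q] (x∈p∪q⁺ {p = F} (inj₂ j∈H))) }
    where
    q∈F∩H = x∈p∩q⁻ F H (subst (q ∈_) (sym F∩H≡q) (x∈⁅x⁆ q))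

  ∣F∣+∣H∣≡2+q : ∣ F ∣ + ∣ H ∣ ≡ 2 + toℕ q
  ∣F∣+∣H∣≡2+q = begin
    ∣ F ∣ + ∣ H ∣         ≡⟨ ∣p∪q∣+∣p∩q∣≡∣p∣+∣q∣ F H ⟨
    ∣ F ∪ H ∣ + ∣ F ∩ H ∣ ≡⟨ cong₂ _+_ (trans (cong ∣_∣ F∪H≡[q]) (∣initial∣ q))
                                      (trans (cong ∣_∣ F∩H≡q) (∣⁅x⁆∣≡1 q)) ⟩
    suc (toℕ q) + 1       ≡⟨ +-comm (suc (toℕ q)) 1 ⟩
    2 + toℕ q             ∎
    where open ≡-Reasoning

module _ {A F H : Subset n} {m : ℕ} {q : Fin n} (A-split : TopSplit A F m q) (FH : Partners F H q) where
  open TopSplit A-split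
  open Partners FH

  ≺⇒head⊆⊎ : ∀ {X} → X ≺ A →
             F ⊆ X ⊎ ∃ λ x → x ∈ X × x ∈ H × x <ᶠ q × (∀ y → y ∈ A → y ∉ X → x <ᶠ y)
  ≺⇒head⊆⊎ (inj₁ A⊆X) = inj₁ (A⊆X ∘ head⊆)
  ≺⇒head⊆⊎ {X} (inj₂ (x , x∈X , x∉A , x<)) with x Fin.≤? q
  ... | no x≰q = inj₁ λ {z} z∈F → decidable-stable (z ∈? X) λ z∉X →
          <⇒≱ (x< z (head⊆ z∈F) z∉X) (≤-trans (F≤q z∈F) (<⇒≤ (≰⇒> x≰q)))
  ... | yes x≤q with cover x≤q
  ...   | inj₁ x∈F = contradiction (head⊆ x∈F) x∉A
  ...   | inj₂ x∈H = inj₂ (x , x∈X , x∈H , Fin.≤∧≢⇒< x≤q (λ { refl → x∉A (head⊆ q∈F) }) , x<)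

  first-difference∈head : ∀ {X i} → ∣ X ∣ ≡ ∣ A ∣ → i ∈ A → i ∉ X →
                          (∀ {j} → j ∈ X → j <ᶠ i → j ∈ A) → i ∈ F
  first-difference∈head {X} {i} ∣X∣≡∣A∣ i∈A i∉X X<i⊆A = decidable-stable (i ∈? F) λ i∉F →
    case ⊆-or-∃∉ X A of λ where
      (inj₁ X⊆A) → contradiction (subst (i ∈_) (sym (⊆∧∣≡∣⇒≡ X⊆A ∣X∣≡∣A∣)) i∈A) i∉X
      (inj₂ (e , e∈X , e∉A)) → e∉A (X<i⊆A e∈X (∉top⇒< {m = m} (e∉A ∘ top⊆) (∉head i∈A i∉F)))

  𝓛-member-between : ∀ {P W} → P ⊆ W → ∣ P ∣ ≤ ∣ A ∣ → ∣ A ∣ ≤ ∣ W ∣ →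
                     (∀ {Y} → P ⊆ Y → ∣ Y ∣ ≡ ∣ A ∣ → Y ≺ A) → ∃ λ Y → 𝓛 A ∣ A ∣ Y × Y ⊆ W
  𝓛-member-between P⊆W ∣P∣≤∣A∣ ∣A∣≤∣W∣ ≺A =
    let Y , P⊆Y , Y⊆W , ∣Y∣≡∣A∣ = ⊆-interpolate P⊆W ∣ A ∣ ∣P∣≤∣A∣ ∣A∣≤∣W∣
    in Y , (∣Y∣≡∣A∣ , ≺A P⊆Y ∣Y∣≡∣A∣) , Y⊆W

  -- The head below i, followed by i (the whole head when i = q), extends inside W to a member of 𝓛(A).
  𝓛-member-within : ∀ {W i} → i ∈ H → i ∈ W → (∀ {j} → j ∈ F → j <ᶠ i → j ∈ W) → ∣ A ∣ ≤ ∣ W ∣ →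
                    ∃ λ Y → 𝓛 A ∣ A ∣ Y × Y ⊆ W
  𝓛-member-within {W} {i} i∈H i∈W F<i⊆W ∣A∣≤∣W∣ with i Fin.≟ q
  ... | yes refl = 𝓛-member-between F⊆W (p⊆q⇒∣p∣≤∣q∣ head⊆) ∣A∣≤∣W∣ ≺-of-head⊆
    where
    F⊆W : F ⊆ W
    F⊆W {j} j∈F with j Fin.≟ i
    ... | yes refl = i∈W
    ... | no j≢i   = F<i⊆W j∈F (Fin.≤∧≢⇒< (F≤q j∈F) j≢i)
  ... | no i≢q = 𝓛-member-between P⊆W ∣P∣≤∣A∣ ∣A∣≤∣W∣ λ P⊆Y _ →
                   ≺-witness (P⊆Y (x∈p∪q⁺ (inj₂ (x∈⁅x⁆ i)))) i∉A (P⊆Y ∘₂ A<i⊆P)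
    where
    i<q : i <ᶠ q
    i<q = Fin.≤∧≢⇒< (H≤q i∈H) i≢q
    i∉F : i ∉ F
    i∉F i∈F = i≢q (meet-at-q i∈F i∈H)
    i∉A : i ∉ A
    i∉A i∈A = i∉F (∈head i∈A (<⇒≤ i<q))
    P : Subset n
    P = (F ∩ initial i) ∪ ⁅ i ⁆
    A<i⊆P : ∀ {y} → y ∈ A → y <ᶠ i → y ∈ P
    A<i⊆P y∈A y<i = x∈p∪q⁺ (inj₁ (x∈p∩q⁺ (∈head y∈A (<⇒≤ (<-trans y<i i<q)) , ∈initial⁺ (<⇒≤ y<i))))
    P⊆W : P ⊆ W
    P⊆W {j} j∈P with x∈p∪q⁻ (F ∩ initial i) ⁅ i ⁆ j∈P
    ... | inj₂ j∈⁅i⁆ = subst (_∈ W) (sym (x∈⁅y⁆⇒x≡y i j∈⁅i⁆)) i∈W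
    ... | inj₁ j∈F∩[i] with j∈F , j≤i ← x∈p∩q⁻ F (initial i) j∈F∩[i] =
      F<i⊆W j∈F (Fin.≤∧≢⇒< (∈initial⁻ j≤i) λ { refl → i∉F j∈F })
    P⊆F-q∪i : P ⊆ (F - q) ∪ ⁅ i ⁆
    P⊆F-q∪i {j} j∈P with x∈p∪q⁻ (F ∩ initial i) ⁅ i ⁆ j∈P
    ... | inj₂ j∈⁅i⁆ = x∈p∪q⁺ (inj₂ j∈⁅i⁆)
    ... | inj₁ j∈F∩[i] with j∈F , j≤i ← x∈p∩q⁻ F (initial i) j∈F∩[i] =
      x∈p∪q⁺ (inj₁ (x∈p∧x≢y⇒x∈p-y j∈F (Fin.<⇒≢ (≤-<-trans (∈initial⁻ j≤i) i<q))))
    ∣P∣≤∣A∣ : ∣ P ∣ ≤ ∣ A ∣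
    ∣P∣≤∣A∣ = ≤-trans (p⊆q⇒∣p∣≤∣q∣ P⊆F-q∪i) (≤-trans (x∈p⇒∣p-x∪⁅y⁆∣≤∣p∣ i q∈F) (p⊆q⇒∣p∣≤∣q∣ head⊆))

  head<q⊆exchange : ∀ {j} (g : Fin n) → j ∈ F → j <ᶠ q → j ∈ (A - q) ∪ ⁅ g ⁆
  head<q⊆exchange g j∈F j<q = x∈p∪q⁺ (inj₁ (x∈p∧x≢y⇒x∈p-y (head⊆ j∈F) (Fin.<⇒≢ j<q)))

  exchange-meets : ∀ {C d g} → d ∈ F → d ∈ C → d <ᶠ q → (∀ {j} → j ∈ H → j <ᶠ d → j ∈ C) →
                   ∀ Y → 𝓛 C ∣ C ∣ Y → Meet ((A - q) ∪ ⁅ g ⁆) Y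
  exchange-meets {C} {d} {g} d∈F d∈C d<q H<d⊆C Y (_ , Y≺C) with Y≺C
  ... | inj₁ C⊆Y = d , head<q⊆exchange g d∈F d<q , C⊆Y d∈C
  ... | inj₂ (y , y∈Y , y∉C , y<) with Fin.<-cmp y d
  ...   | tri≈ _ refl _ = contradiction d∈C y∉C
  ...   | tri> _ _ d<y  = d , head<q⊆exchange g d∈F d<q ,
                          decidable-stable (d ∈? Y) λ d∉Y → <-asym d<y (y< d d∈C d∉Y)
  ...   | tri< y<d _ _ with cover (<⇒≤ (<-trans y<d d<q))
  ...     | inj₁ y∈F = y , head<q⊆exchange g y∈F (<-trans y<d d<q) , y∈Y
  ...     | inj₂ y∈H = contradiction (H<d⊆C y∈H y<d) y∉C

  -- The least point d of H ∖ C or of (F ∩ C) ∖ {q} cannot exist: below d, C contains H and avoids F,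
  -- so either a member of 𝓛(A) avoids C (d ∈ H), or the exchange set (A - q) ∪ {g} meets all of 𝓛(C)
  -- without lying in 𝓛(A) (d ∈ F).
  partner⊆maximal : ∀ {C g} → g ∉ A → q <ᶠ g → ∣ A ∣ + ∣ C ∣ ≤ n → Maximal A C → H ⊆ C
  partner⊆maximal {C} {g} g∉A q<g ∣A∣+∣C∣≤n AC {j} j∈H = decidable-stable (j ∈? C) λ j∉C →
    let d , d-disagrees , below-d = least disagreement? (j , inj₁ (j∈H , j∉C))
    in no-least d-disagrees below-d
    where
    Disagreement : Fin n → Set
    Disagreement x = x ∈ H × x ∉ C ⊎ x ∈ F × x ∈ C × x <ᶠ q
    disagreement? : Decidable Disagreement
    disagreement? x = (x ∈? H ×-dec ¬? (x ∈? C)) ⊎-dec (x ∈? F ×-dec x ∈? C ×-dec x Fin.<? q)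
    no-least : ∀ {d} → Disagreement d → (∀ {x} → x <ᶠ d → ¬ Disagreement x) → ⊥
    no-least {d} (inj₁ (d∈H , d∉C)) below-d =
      let Y , Y∈𝓛A , Y⊆∁C = 𝓛-member-within d∈H (x∉p⇒x∈∁p d∉C) F<d⊆∁C (+∣p∣≤n⇒≤∣∁p∣ C ∣A∣+∣C∣≤n)
      in Meet⇒⊈∁ (Meet-sym (proj₁ AC Y C Y∈𝓛A (𝓛-refl C))) Y⊆∁C
      where
      F<d⊆∁C : ∀ {x} → x ∈ F → x <ᶠ d → x ∈ ∁ C
      F<d⊆∁C {x} x∈F x<d = x∉p⇒x∈∁p λ x∈C → below-d x<d (inj₂ (x∈F , x∈C , <-≤-trans x<d (H≤q d∈H)))
    no-least {d} (inj₂ (d∈F , d∈C , d<q)) below-d =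
      exchange-⊀ q∈A g∉A q<g (maximal⇒≺ˡ AC (∣exchange∣ q∈A g∉A) (exchange-meets d∈F d∈C d<q H<d⊆C))
      where
      q∈A = head⊆ q∈F
      H<d⊆C : ∀ {x} → x ∈ H → x <ᶠ d → x ∈ C
      H<d⊆C {x} x∈H x<d = decidable-stable (x ∈? C) λ x∉C → below-d x<d (inj₁ (x∈H , x∉C))

module _ {A F C H : Subset n} {mA mC : ℕ} {q : Fin n}
         (A-split : TopSplit A F mA q) (C-split : TopSplit C H mC q) (FH : Partners F H q) where
  open Partners FH
  private
    module A = TopSplit A-split
    module C = TopSplit C-split

  cross-intersecting : CrossIntersecting (𝓛 A ∣ A ∣) (𝓛 C ∣ C ∣)
  cross-intersecting X Y (_ , X≺A) (_ , Y≺C)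
    with ≺⇒head⊆⊎ A-split FH X≺A | ≺⇒head⊆⊎ C-split (Partners-sym FH) Y≺C
  ... | inj₁ F⊆X                 | inj₁ H⊆Y                 = q , F⊆X q∈F , H⊆Y q∈H
  ... | inj₁ F⊆X                 | inj₂ (y , y∈Y , y∈F , _) = y , F⊆X y∈F , y∈Y
  ... | inj₂ (x , x∈X , x∈H , _) | inj₁ H⊆Y                 = x , x∈X , H⊆Y x∈H
  ... | inj₂ (x , x∈X , x∈H , x<q , x<) | inj₂ (y , y∈Y , y∈F , _ , y<) with Fin.<-cmp x y
  ...   | tri< x<y _ _  = x , x∈X , decidable-stable (x ∈? Y) λ x∉Y → <-asym x<y (y< x (C.head⊆ x∈H) x∉Y)
  ...   | tri≈ _ refl _ = contradiction (meet-at-q y∈F x∈H) (Fin.<⇒≢ x<q)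
  ...   | tri> _ _ y<x  = y , decidable-stable (y ∈? X) (λ y∉X → <-asym y<x (x< y (A.head⊆ y∈F) y∉X)) ,
                          y∈Y

  ≺-or-avoided : ∣ A ∣ + ∣ C ∣ ≤ n → ∀ X → ∣ X ∣ ≡ ∣ A ∣ → X ≺ A ⊎ ∃ λ Y → 𝓛 C ∣ C ∣ Y × Y ⊆ ∁ X
  ≺-or-avoided ∣A∣+∣C∣≤n X ∣X∣≡∣A∣ with ⊆-or-∃∉ A X
  ... | inj₁ A⊆X = inj₁ (inj₁ A⊆X)
  ... | inj₂ A⊈X with least (λ j → j ∈? A ×-dec ¬? (j ∈? X)) A⊈X
  ...   | i , (i∈A , i∉X) , below-i with Fin.any? (λ j → j ∈? X ×-dec ¬? (j ∈? A) ×-dec j Fin.<? i)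
  ...     | yes (j , j∈X , j∉A , j<i) = inj₁ (inj₂ (j , j∈X , j∉A , λ y y∈A y∉X →
              <-≤-trans j<i (≮⇒≥ λ y<i → below-i y<i (y∈A , y∉X))))
  ...     | no ∄j = inj₂ (𝓛-member-within C-split (Partners-sym FH) i∈F (x∉p⇒x∈∁p i∉X) H<i⊆∁X ∣C∣≤∣∁X∣)
    where
    X<i⊆A : ∀ {j} → j ∈ X → j <ᶠ i → j ∈ A
    X<i⊆A {j} j∈X j<i = decidable-stable (j ∈? A) λ j∉A → ∄j (j , j∈X , j∉A , j<i)
    i∈F : i ∈ F
    i∈F = first-difference∈head A-split FH ∣X∣≡∣A∣ i∈A i∉X X<i⊆A
    H<i⊆∁X : ∀ {j} → j ∈ H → j <ᶠ i → j ∈ ∁ X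
    H<i⊆∁X {j} j∈H j<i = x∉p⇒x∈∁p λ j∈X →
      Fin.<⇒≢ j<q (meet-at-q (A.∈head (X<i⊆A j∈X j<i) (<⇒≤ j<q)) j∈H)
      where j<q = <-≤-trans j<i (F≤q i∈F)
    ∣C∣≤∣∁X∣ : ∣ C ∣ ≤ ∣ ∁ X ∣
    ∣C∣≤∣∁X∣ = +∣p∣≤n⇒≤∣∁p∣ X (subst (λ a → ∣ C ∣ + a ≤ n) (sym ∣X∣≡∣A∣)
                                   (subst (_≤ n) (+-comm ∣ A ∣ ∣ C ∣) ∣A∣+∣C∣≤n))

partners-maximal : ∀ {A F C H : Subset n} {mA mC q} → TopSplit A F mA q → TopSplit C H mC q →
                   Partners F H q → ∣ A ∣ + ∣ C ∣ ≤ n → Maximal A C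
partners-maximal {n} {A = A} {C = C} A-split C-split FH ∣A∣+∣C∣≤n = maximal-intro
  (cross-intersecting A-split C-split FH)
  (≺-or-avoided A-split C-split FH ∣A∣+∣C∣≤n)
  (≺-or-avoided C-split A-split (Partners-sym FH) (subst (_≤ n) (+-comm ∣ A ∣ ∣ C ∣) ∣A∣+∣C∣≤n))

-- Tails

top-ℓ⊆ : (R : Subset n) → top n (ℓ R) ⊆ R
top-ℓ⊆ {n} R = top-findMax⊆ n
  where
  top-findMax⊆ : ∀ x → top n (findMax R x) ⊆ R
  top-findMax⊆ zero = ⊥-elim ∘ top-zero-empty
  top-findMax⊆ (suc x) with top n (suc x) ⊆? R
  ... | yes top⊆R = top⊆R
  ... | no _      = top-findMax⊆ x

≤ℓ : ∀ {m} (R : Subset n) → m ≤ n → top n m ⊆ R → m ≤ ℓ R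
≤ℓ {n} R = ≤findMax n
  where
  ≤findMax : ∀ x {m} → m ≤ x → top n m ⊆ R → m ≤ findMax R x
  ≤findMax zero    z≤n      _     = z≤n
  ≤findMax (suc x) m≤1+x top⊆R with top n (suc x) ⊆? R
  ... | yes _    = m≤1+x
  ... | no top⊈R with m≤n⇒m<n∨m≡n m≤1+x
  ...   | inj₁ m<1+x = ≤findMax x (s≤s⁻¹ m<1+x) top⊆R
  ...   | inj₂ refl  = contradiction (λ {x} → top⊆R {x}) top⊈R

ℓ<-of-∉ : ∀ {m} {R : Subset n} {j} → j ∉ R → j ∈ top n m → ℓ R < m
ℓ<-of-∉ {R = R} j∉R j∈top = ≰⇒> λ m≤ℓ → j∉R (top-ℓ⊆ R (top-mono m≤ℓ j∈top))

-- The largest element outside top n m; the element j only witnesses that there is one.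
module _ (m : ℕ) {j : Fin n} (j∉top : j ∉ top n m) where
  private
    j<n∸m : toℕ j < n ∸ m
    j<n∸m = ≰⇒> (j∉top ∘ ∈top⁺ m)
    1+pred≡n∸m : suc (pred (n ∸ m)) ≡ n ∸ m
    1+pred≡n∸m = suc-pred (n ∸ m) {{>-nonZero (≤-trans (s≤s z≤n) j<n∸m)}}

  below-top : Fin n
  below-top = fromℕ< (≤-trans (≤-reflexive 1+pred≡n∸m) (m∸n≤m n m))

  1+below-top≡n∸m : suc (toℕ below-top) ≡ n ∸ m
  1+below-top≡n∸m = trans (cong suc (Fin.toℕ-fromℕ< _)) 1+pred≡n∸m

  below-top∉top : below-top ∉ top n m
  below-top∉top g∈top = <⇒≱ (≤-reflexive 1+below-top≡n∸m) (∈top⁻ m g∈top)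

  toℕ-below-top : toℕ below-top ≡ n ∸ suc m
  toℕ-below-top = trans (Fin.toℕ-fromℕ< _) (pred[m∸n]≡m∸[1+n] n m)

  below-top∈top : below-top ∈ top n (suc m)
  below-top∈top = ∈top⁺ (suc m) (≤-reflexive (sym toℕ-below-top))

  ≤below-top : j ≤ᶠ below-top
  ≤below-top = s≤s⁻¹ (subst (suc (toℕ j) ≤_) (sym 1+below-top≡n∸m) j<n∸m)

  top-suc⊆ : ∀ {i} → i ∈ top n (suc m) → i ∈ top n m ⊎ i ≡ below-top
  top-suc⊆ {i} i∈top with n ∸ m ≤? toℕ i
  ... | yes n∸m≤i = inj₁ (∈top⁺ m n∸m≤i)
  ... | no  n∸m≰i = inj₂ (Fin.toℕ-injective (≤-antisym
        (s≤s⁻¹ (subst (toℕ i <_) (sym 1+below-top≡n∸m) (≰⇒> n∸m≰i)))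
        (subst (_≤ toℕ i) (sym toℕ-below-top) (∈top⁻ (suc m) i∈top))))

module _ (A : Subset n) {q : Fin n} (q∈F : q ∈ A ─ tail A) where
  private
    q∉tail : q ∉ top n (ℓ A)
    q∉tail = x∈p─q⇒x∉q A (tail A) q∈F

  head-split : TopSplit A (A ─ tail A) (ℓ A) q
  head-split = record
    { head⊆ = p─q⊆p A (tail A)
    ; top⊆  = top-ℓ⊆ A
    ; ∉head = λ {j} j∈A j∉F → decidable-stable (j ∈? tail A) λ j∉tail → j∉F (x∈p∧x∉q⇒x∈p─q j∈A j∉tail)
    ; above = ∉top⇒< {m = ℓ A} q∉tail }

  gap-above-head : ∃ λ g → g ∉ A × q <ᶠ g
  gap-above-head = g , g∉A , Fin.≤∧≢⇒< (≤below-top (ℓ A) q∉tail) (λ q≡g → g∉A (subst (_∈ A) q≡g q∈A))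
    where
    q∈A = p─q⊆p A (tail A) q∈F
    g = below-top (ℓ A) q∉tail
    g∉A : g ∉ A
    g∉A g∈A = <-irrefl refl (≤ℓ A (∉top⇒<n (ℓ A) q∉tail) λ i∈top →
      case top-suc⊆ (ℓ A) q∉tail i∈top of λ where
        (inj₁ i∈tail) → top-ℓ⊆ A i∈tail
        (inj₂ refl)   → g∈A)

module _ {H : Subset n} {q : Fin n} (H≤q : ∀ {j} → j ∈ H → j ≤ᶠ q) {m : ℕ} (room : 2 + toℕ q + m ≤ n)
         where
  private
    q+1<n∸m : suc (toℕ q) < n ∸ m
    q+1<n∸m = m+n≤o⇒m≤o∸n (2 + toℕ q) room
    q∉top : q ∉ top n m
    q∉top q∈top = <⇒≱ (<-trans (n<1+n _) q+1<n∸m) (∈top⁻ m q∈top)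
    H∉top : ∀ {j} → j ∈ H → j ∉ top n m
    H∉top j∈H j∈top = <⇒≱ (∉top⇒< {m = m} q∉top j∈top) (H≤q j∈H)

  padded-split : TopSplit (H ∪ top n m) H m q
  padded-split = record
    { head⊆ = p⊆p∪q (top n m)
    ; top⊆  = q⊆p∪q H (top n m)
    ; ∉head = λ j∈H∪top j∉H → case x∈p∪q⁻ H (top n m) j∈H∪top of λ where
                (inj₁ j∈H)   → contradiction j∈H j∉H
                (inj₂ j∈top) → j∈top
    ; above = ∉top⇒< {m = m} q∉top }

  ∣padded∣ : ∣ H ∪ top n m ∣ ≡ ∣ H ∣ + m
  ∣padded∣ = trans (Empty-∩⇒∣p∪q∣≡∣p∣+∣q∣ H (top n m) disjoint)
                   (cong (∣ H ∣ +_) (∣top∣ n m (≤-trans (m≤n+m m _) room)))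
    where
    disjoint : Empty (H ∩ top n m)
    disjoint (j , j∈) = let j∈H , j∈top = x∈p∩q⁻ H (top n m) j∈ in H∉top j∈H j∈top

  ℓ-padded : ℓ (H ∪ top n m) ≡ m
  ℓ-padded = ≤-antisym (s≤s⁻¹ (ℓ<-of-∉ g∉ (below-top∈top m q∉top)))
                       (≤ℓ (H ∪ top n m) (≤-trans (m≤n+m m _) room) (q⊆p∪q H (top n m)))
    where
    q<g : q <ᶠ below-top m q∉top
    q<g = s≤s⁻¹ (subst (suc (toℕ q) <_) (sym (1+below-top≡n∸m m q∉top)) q+1<n∸m)
    g∉ : below-top m q∉top ∉ H ∪ top n m
    g∉ g∈ = case x∈p∪q⁻ H (top n m) g∈ of λ where
      (inj₁ g∈H)   → <⇒≱ q<g (H≤q g∈H)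
      (inj₂ g∈top) → below-top∉top m q∉top g∈top

  head-padded : (H ∪ top n m) ─ tail (H ∪ top n m) ≡ H
  head-padded = ⊆-antisym
    (λ {j} j∈ → case x∈p∪q⁻ H (top n m) (p─q⊆p _ _ j∈) of λ where
       (inj₁ j∈H)   → j∈H
       (inj₂ j∈top) → contradiction (subst (λ t → j ∈ top n t) (sym ℓ-padded) j∈top) (x∈p─q⇒x∉q _ _ j∈))
    (λ j∈H → x∈p∧x∉q⇒x∈p─q (p⊆p∪q (top n m) j∈H) (subst (λ t → _ ∉ top n t) (sym ℓ-padded) (H∉top j∈H)))

module HeadPartner {A H : Subset n} {q : Fin n}
                   (F∩H≡q : (A ─ tail A) ∩ H ≡ ⁅ q ⁆) (F∪H≡[q] : (A ─ tail A) ∪ H ≡ initial q) where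
  private
    FH : Partners (A ─ tail A) H q
    FH = partners F∩H≡q F∪H≡[q]
    open Partners FH
    A-split : TopSplit A (A ─ tail A) (ℓ A) q
    A-split = head-split A q∈F

    room : ∀ {m} → ∣ A ∣ + (∣ H ∣ + m) ≤ n → 2 + toℕ q + m ≤ n
    room {m} ∣A∣+∣H∣+m≤n = begin
      2 + toℕ q + m                 ≡⟨ cong (_+ m) (∣F∣+∣H∣≡2+q F∩H≡q F∪H≡[q]) ⟨
      ∣ A ─ tail A ∣ + ∣ H ∣ + m   ≡⟨ +-assoc ∣ A ─ tail A ∣ ∣ H ∣ m ⟩
      ∣ A ─ tail A ∣ + (∣ H ∣ + m) ≤⟨ +-monoˡ-≤ (∣ H ∣ + m) (∣p─q∣≤∣p∣ A (tail A)) ⟩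
      ∣ A ∣ + (∣ H ∣ + m)          ≤⟨ ∣A∣+∣H∣+m≤n ⟩
      n                             ∎
      where open ≤-Reasoning

  partner-maximal : ∣ A ∣ + ∣ H ∣ ≤ n → Maximal A H
  partner-maximal = partners-maximal A-split H-split FH
    where
    H-split : TopSplit H H 0 q
    H-split = record { head⊆ = λ j∈H → j∈H ; top⊆ = ⊥-elim ∘ top-zero-empty
                     ; ∉head = λ j∈H j∉H → contradiction j∈H j∉H ; above = ⊥-elim ∘ top-zero-empty }

  padded-maximal : ∀ {m} → ∣ A ∣ + (∣ H ∣ + m) ≤ n → Maximal A (H ∪ top n m)
  padded-maximal le = partners-maximal A-split (padded-split H≤q (room le)) FH
    (subst (λ c → ∣ A ∣ + c ≤ n) (sym (∣padded∣ H≤q (room le))) le)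

  partner⊆ : ∀ {C} → ∣ A ∣ + ∣ C ∣ ≤ n → Maximal A C → H ⊆ C
  partner⊆ = let g , g∉A , q<g = gap-above-head A q∈F in partner⊆maximal A-split FH g∉A q<g

  padding-fits : ∀ {C} → ∣ A ∣ + ∣ C ∣ ≤ n → Maximal A C → ∣ A ∣ + (∣ H ∣ + (∣ C ∣ ∸ ∣ H ∣)) ≤ n
  padding-fits {C} ∣A∣+∣C∣≤n AC =
    subst (λ c → ∣ A ∣ + c ≤ n) (sym (m+[n∸m]≡n (p⊆q⇒∣p∣≤∣q∣ (partner⊆ ∣A∣+∣C∣≤n AC)))) ∣A∣+∣C∣≤n

  maximal⇒padded : ∀ {C} → ∣ A ∣ + ∣ C ∣ ≤ n → Maximal A C → C ≡ H ∪ top n (∣ C ∣ ∸ ∣ H ∣)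
  maximal⇒padded ∣A∣+∣C∣≤n AC = maximal-unique AC (padded-maximal fits)
    (sym (trans (∣padded∣ H≤q (room fits)) (m+[n∸m]≡n (p⊆q⇒∣p∣≤∣q∣ (partner⊆ ∣A∣+∣C∣≤n AC)))))
    where fits = padding-fits ∣A∣+∣C∣≤n AC

  maximal⇒∣head∣ : ∀ {C} → ∣ A ∣ + ∣ C ∣ ≤ n → Maximal A C → ∣ C ─ tail C ∣ ≡ ∣ H ∣
  maximal⇒∣head∣ ∣A∣+∣C∣≤n AC = trans (cong (λ X → ∣ X ─ tail X ∣) (maximal⇒padded ∣A∣+∣C∣≤n AC))
                                      (cong ∣_∣ (head-padded H≤q (room (padding-fits ∣A∣+∣C∣≤n AC))))

fact2p9 : (a b k n : ℕ) → 1 ≤ a → 1 ≤ b → 1 ≤ k → (a + b) ⊔ (a + k) ≤ n →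
          (A : Subset n) → ∣ A ∣ ≡ a →
          (K : Subset n) → IsKPartner k (A ─ tail A) K →
          (B : Subset n) → ∣ B ∣ ≡ b → Maximal A B →
          (Maximal A K ⇔ ∣ B ─ tail B ∣ ≤ k)
fact2p9 _ _ k n _ _ _ size A refl K (_ , H , (q , F∩H≡q , F∪H≡[q]) , K-cases) B refl AB =
  mk⇔ (λ AK → subst (_≤ k) (sym b′≡∣H∣) (∣H∣≤k AK)) (K-maximal ∘ subst (_≤ k) b′≡∣H∣)
  where
  open HeadPartner F∩H≡q F∪H≡[q]
  ∣A∣+k≤n : ∣ A ∣ + k ≤ n
  ∣A∣+k≤n = m⊔n≤o⇒n≤o (∣ A ∣ + ∣ B ∣) (∣ A ∣ + k) size
  b′≡∣H∣ : ∣ B ─ tail B ∣ ≡ ∣ H ∣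
  b′≡∣H∣ = maximal⇒∣head∣ (m⊔n≤o⇒m≤o (∣ A ∣ + ∣ B ∣) (∣ A ∣ + k) size) AB
  ∣H∣≤k : Maximal A K → ∣ H ∣ ≤ k
  ∣H∣≤k AK = case K-cases of λ where
    (inj₁ (k≡∣H∣ , _))              → ≤-reflexive (sym k≡∣H∣)
    (inj₂ (inj₁ (∣H∣<k , _)))       → <⇒≤ ∣H∣<k
    (inj₂ (inj₂ (_ , ∣K∣≡k , _))) → subst (∣ H ∣ ≤_) ∣K∣≡k
      (p⊆q⇒∣p∣≤∣q∣ (partner⊆ (subst (λ c → ∣ A ∣ + c ≤ n) (sym ∣K∣≡k) ∣A∣+k≤n) AK))
  K-maximal : ∣ H ∣ ≤ k → Maximal A K
  K-maximal ∣H∣≤k = case K-cases of λ where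
    (inj₁ (k≡∣H∣ , K≡H)) →
      subst (Maximal A) (sym K≡H) (partner-maximal (subst (λ c → ∣ A ∣ + c ≤ n) k≡∣H∣ ∣A∣+k≤n))
    (inj₂ (inj₁ (∣H∣<k , K≡padded))) → subst (Maximal A) (sym K≡padded)
      (padded-maximal (subst (λ c → ∣ A ∣ + c ≤ n) (sym (m+[n∸m]≡n (<⇒≤ ∣H∣<k))) ∣A∣+k≤n))
    (inj₂ (inj₂ (k<∣H∣ , _))) → contradiction ∣H∣≤k (<⇒≱ k<∣H∣)
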